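{- Let $\langle A;\cdot,0,\Diamond\rangle$ be a monadic quasi-implication algebra. On $A\setminus\{0\}$ define $x\perp^M_A y$ iff $x\cdot(y\cdot 0)=1$, and $x R^M_A y$ iff $y\cdot\Diamond x=1$. Then $\langle A\setminus\{0\};\perp^M_A,R^M_A\rangle$ is a monadic orthoframe.
   Context: A quasi-implication algebra is a magma $\langle A;\cdot\rangle$ satisfying, for all $x,y,z$: (1) $(x\cdot y)\cdot x=x$; (2) $(x\cdot y)\cdot(x\cdot z)=(y\cdot x)\cdot(y\cdot z)$; (3) $((x\cdot y)\cdot(y\cdot x))\cdot x=((y\cdot x)\cdot(x\cdot y))\cdot y$. In any quasi-implication algebra $x\cdot x=y\cdot y$ for all $x,y$, and $1$ denotes this common element. A bounded quasi-implication algebra is a quasi-implication algebra with a distinguished element $0$ such that $0\cdot x=1$ for all $x$. A monadic quasi-implication algebra is an algebra $\langle A;\cdot,0,\Diamond\rangle$ such that $\langle A;\cdot,0\rangle$ is a bounded quasi-implication algebra and $\Diamond\colon A\to A$ satisfies, for all $x,y$: (a) $\Diamond\Diamond x\cdot\Diamond x=1$ and $x\cdot\Diamond x=1$; (b) $\Diamond(\Diamond x\cdot 0)=\Diamond x\cdot 0$ and $\Diamond 0=0$; (c) $\Diamond(((x\cdot 0)\cdot(y\cdot 0))\cdot x)=((\Diamond x\cdot 0)\cdot(\Diamond y\cdot 0))\cdot\Diamond x$. For a relation $R$ on a set $X$ and $U\subseteq X$, $R[U]=\{y\in X: uRy\text{ for some }u\in U\}$; for a relation $\perp$ on $X$, $U^{\perp}=\{y\in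 X: y\perp u\text{ for all }u\in U\}$. A monadic orthoframe is a triple $\langle X;\perp,R\rangle$ where $\perp$ is an irreflexive symmetric relation on $X$, $R$ is a reflexive transitive relation on $X$, and $R[R[\{x\}]^{\perp}]\subseteq R[\{x\}]^{\perp}$ for all $x\in X$. -}

module Defs where

open import Level using (Level; _⊔_; suc)
open import Data.Product using (Σ; ∃; _×_; _,_)
open import Relation.Binary.PropositionalEquality using (_≡_)
open import Relation.Nullary using (¬_)

record MonadicQIA (a : Level) : Set (suc a) where
  infixl 7 _·_
  field
    Carrier : Set a
    _·_     : Carrier → Carrier → Carrier
    𝟘       : Carrier
    ◇       : Carrier → Carrier
    qi1 : ∀ x y → (x · y) · x ≡ x
    qi2 : ∀ x y z → (x · y) · (x · z) ≡ (y · x) · (y · z)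
    qi3 : ∀ x y → ((x · y) · (y · x)) · x ≡ ((y · x) · (x · y)) · y
  -- 1 is the common value of x · x (it is provable that x · x = y · y)
  𝟙 : Carrier
  𝟙 = 𝟘 · 𝟘
  field
    bounded : ∀ x → 𝟘 · x ≡ 𝟙
    m-a1 : ∀ x → ◇ (◇ x) · ◇ x ≡ 𝟙
    m-a2 : ∀ x → x · ◇ x ≡ 𝟙
    m-b1 : ∀ x → ◇ (◇ x · 𝟘) ≡ ◇ x · 𝟘
    m-b2 : ◇ 𝟘 ≡ 𝟘
    m-c  : ∀ x y → ◇ (((x · 𝟘) · (y · 𝟘)) · x) ≡ ((◇ x · 𝟘) · (◇ y · 𝟘)) · ◇ x

module _ {ℓ : Level} {X : Set ℓ} where

  image : (R : X → X → Set ℓ) → (X → Set ℓ) → X → Set ℓ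
  image R U y = ∃ λ u → U u × R u y

  orth : (P : X → X → Set ℓ) → (X → Set ℓ) → X → Set ℓ
  orth P U y = ∀ u → U u → P y u

  singleton : X → X → Set ℓ
  singleton a b = a ≡ b

record IsMonadicOrthoframe {ℓ : Level} (X : Set ℓ) (P R : X → X → Set ℓ) : Set ℓ where
  field
    ⊥-irrefl : ∀ a → ¬ P a a
    ⊥-sym    : ∀ a b → P a b → P b a
    R-refl   : ∀ a → R a a
    R-trans  : ∀ a b c → R a b → R b c → R a c
    cond     : ∀ a y →
      image R (orth P (image R (singleton a))) y →
      orth P (image R (singleton a)) y

module Induced {a : Level} (𝔸 : MonadicQIA a) where
  open MonadicQIA 𝔸

  A⁺ : Set a
  A⁺ = Σ Carrier (λ v → ¬ v ≡ 𝟘)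

  _⊥ᴹ_ : A⁺ → A⁺ → Set a
  (u , _) ⊥ᴹ (v , _) = u · (v · 𝟘) ≡ 𝟙

  _Rᴹ_ : A⁺ → A⁺ → Set a
  (u , _) Rᴹ (v , _) = v · ◇ u ≡ 𝟙

module Submission where

-- Write x ≤ y for x · y = 1. In a bounded quasi-implication algebra ≤ is a
-- preorder, x ↦ x · 0 is an order-reversing involution, and x ≤ y makes
-- (y · x) · x equal to y; axiom (c) then says ◇ is monotone. With these,
-- ⊥ᴹ is "u ≤ v · 0" and u Rᴹ v is "v ≤ ◇ u", and the frame axioms reduce to
-- chains of inequalities through ◇ a, ◇ (◇ a) and ◇ a · 0.

open import Level using (Level)
open import Data.Product using (_,_)
open import Relation.Binary.PropositionalEquality
open import Relation.Nullary using (¬_)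
open import Defs

module BoundedQIA
  {a : Level} {A : Set a} (_·_ : A → A → A) (𝟘 : A)
  (qi1 : ∀ x y → (x · y) · x ≡ x)
  (qi2 : ∀ x y z → (x · y) · (x · z) ≡ (y · x) · (y · z))
  (qi3 : ∀ x y → ((x · y) · (y · x)) · x ≡ ((y · x) · (x · y)) · y)
  (bounded : ∀ x → 𝟘 · x ≡ 𝟘 · 𝟘)
  where

  open ≡-Reasoning

  infix 30 _′
  infix 4 _≤_

  𝟙 : A
  𝟙 = 𝟘 · 𝟘

  _′ : A → A
  x ′ = x · 𝟘

  _≤_ : A → A → Set a
  x ≤ y = x · y ≡ 𝟙

  𝟙·𝟘≡𝟘 : 𝟙 · 𝟘 ≡ 𝟘
  𝟙·𝟘≡𝟘 = qi1 𝟘 𝟘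

  𝟙·𝟙≡𝟙 : 𝟙 · 𝟙 ≡ 𝟙
  𝟙·𝟙≡𝟙 = begin
    𝟙 · 𝟙                ≡⟨ cong (_· 𝟙) (sym (bounded 𝟙)) ⟩
    (𝟘 · 𝟙) · (𝟘 · 𝟘)    ≡⟨ qi2 𝟘 𝟙 𝟘 ⟩
    (𝟙 · 𝟘) · (𝟙 · 𝟘)    ≡⟨ cong₂ _·_ 𝟙·𝟘≡𝟘 𝟙·𝟘≡𝟘 ⟩
    𝟙                    ∎

  x′≤x·y : ∀ x y → x ′ ≤ x · y
  x′≤x·y x y = begin
    (x · 𝟘) · (x · y)    ≡⟨ qi2 x 𝟘 y ⟩
    (𝟘 · x) · (𝟘 · y)    ≡⟨ cong₂ _·_ (bounded x) (bounded y) ⟩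
    𝟙 · 𝟙                ≡⟨ 𝟙·𝟙≡𝟙 ⟩
    𝟙                    ∎

  x·x′≡x′ : ∀ x → x · x ′ ≡ x ′
  x·x′≡x′ x = begin
    x · x ′              ≡⟨ cong (_· x ′) (sym (qi1 x 𝟘)) ⟩
    (x ′ · x) · x ′      ≡⟨ qi1 (x ′) x ⟩
    x ′                  ∎

  ≤-refl : ∀ x → x ≤ x
  ≤-refl x = begin
    x · x                        ≡⟨ cong₂ _·_ (sym (qi1 x 𝟘)) (sym (qi1 x 𝟘)) ⟩
    (x ′ · x) · (x ′ · x)        ≡⟨ sym (qi2 x (x ′) x) ⟩
    (x · x ′) · (x · x)          ≡⟨ cong (_· (x · x)) (x·x′≡x′ x) ⟩
    x ′ · (x · x)                ≡⟨ x′≤x·y x x ⟩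
    𝟙                            ∎

  ≤𝟙 : ∀ x → x ≤ 𝟙
  ≤𝟙 x = begin
    x · 𝟙                        ≡⟨ cong₂ _·_ (sym (qi1 x 𝟘)) (sym (≤-refl (x ′))) ⟩
    (x ′ · x) · (x ′ · x ′)      ≡⟨ qi2 (x ′) x (x ′) ⟩
    (x · x ′) · (x · x ′)        ≡⟨ ≤-refl (x · x ′) ⟩
    𝟙                            ∎

  𝟙·x≡x : ∀ x → 𝟙 · x ≡ x
  𝟙·x≡x x = subst (λ t → t · x ≡ x) (≤𝟙 x) (qi1 x 𝟙)

  x′′≡x : ∀ x → x ′ ′ ≡ x
  x′′≡x x = sym (begin
    x                            ≡⟨ sym (𝟙·x≡x x) ⟩
    𝟙 · x                        ≡⟨ cong (_· x) (sym (≤𝟙 (x ′))) ⟩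
    (x ′ · 𝟙) · x                ≡⟨ cong (λ t → (x ′ · t) · x) (sym (bounded x)) ⟩
    (x ′ · (𝟘 · x)) · x          ≡⟨ qi3 x 𝟘 ⟩
    ((𝟘 · x) · x ′) · 𝟘          ≡⟨ cong (λ t → (t · x ′) · 𝟘) (bounded x) ⟩
    (𝟙 · x ′) · 𝟘                ≡⟨ cong (_· 𝟘) (𝟙·x≡x (x ′)) ⟩
    x ′ ′                        ∎)

  ≤⇒·-exchange : ∀ {x y} z → x ≤ y → x · z ≡ (y · x) · (y · z)
  ≤⇒·-exchange {x} {y} z x≤y = begin
    x · z                        ≡⟨ sym (𝟙·x≡x (x · z)) ⟩
    𝟙 · (x · z)                  ≡⟨ cong (_· (x · z)) (sym x≤y) ⟩
    (x · y) · (x · z)            ≡⟨ qi2 x y z ⟩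
    (y · x) · (y · z)            ∎

  ≤-trans : ∀ {x y z} → x ≤ y → y ≤ z → x ≤ z
  ≤-trans {x} {y} {z} x≤y y≤z = begin
    x · z                        ≡⟨ ≤⇒·-exchange z x≤y ⟩
    (y · x) · (y · z)            ≡⟨ cong ((y · x) ·_) y≤z ⟩
    (y · x) · 𝟙                  ≡⟨ ≤𝟙 (y · x) ⟩
    𝟙                            ∎

  ≤⇒[y·x]·x≡y : ∀ {x y} → x ≤ y → (y · x) · x ≡ y
  ≤⇒[y·x]·x≡y {x} {y} x≤y = begin
    (y · x) · x                  ≡⟨ cong (_· x) (sym (𝟙·x≡x (y · x))) ⟩
    (𝟙 · (y · x)) · x            ≡⟨ cong (λ t → (t · (y · x)) · x) (sym x≤y) ⟩
    ((x · y) · (y · x)) · x      ≡⟨ qi3 x y ⟩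
    ((y · x) · (x · y)) · y      ≡⟨ cong (λ t → ((y · x) · t) · y) x≤y ⟩
    ((y · x) · 𝟙) · y            ≡⟨ cong (_· y) (≤𝟙 (y · x)) ⟩
    𝟙 · y                        ≡⟨ 𝟙·x≡x y ⟩
    y                            ∎

  ≤⇒x′≡[y·x]·y′ : ∀ {x y} → x ≤ y → x ′ ≡ (y · x) · y ′
  ≤⇒x′≡[y·x]·y′ = ≤⇒·-exchange 𝟘

  ≤⇒x′·y′≡y·x : ∀ {x y} → x ≤ y → x ′ · y ′ ≡ y · x
  ≤⇒x′·y′≡y·x {x} {y} x≤y = begin
    x ′ · y ′                    ≡⟨ cong (_· y ′) (≤⇒x′≡[y·x]·y′ x≤y) ⟩
    ((y · x) · y ′) · y ′        ≡⟨ ≤⇒[y·x]·x≡y (x′≤x·y y x) ⟩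
    y · x                        ∎

  ′-antitone : ∀ {x y} → x ≤ y → y ′ ≤ x ′
  ′-antitone {x} {y} x≤y = begin
    y ′ · x ′                    ≡⟨ ≤⇒·-exchange (x ′) (x′≤x·y y x) ⟩
    (w · y ′) · (w · x ′)        ≡⟨ cong (λ t → t · (w · x ′)) (sym (≤⇒x′≡[y·x]·y′ x≤y)) ⟩
    x ′ · (w · x ′)              ≡⟨ cong (λ t → x ′ · (t · x ′)) (sym (≤⇒x′·y′≡y·x x≤y)) ⟩
    x ′ · ((x ′ · y ′) · x ′)    ≡⟨ cong (x ′ ·_) (qi1 (x ′) (y ′)) ⟩
    x ′ · x ′                    ≡⟨ ≤-refl (x ′) ⟩
    𝟙                            ∎
    where w = y · x

  ′-reflects-≤ : ∀ {x y} → x ′ ≤ y ′ → y ≤ x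
  ′-reflects-≤ {x} {y} x′≤y′ =
    subst₂ _≤_ (x′′≡x y) (x′′≡x x) (′-antitone x′≤y′)

  ≤⇒≤·-self : ∀ {u c} → u ≤ c → u ≤ c · u
  ≤⇒≤·-self {u} {c} u≤c = ′-reflects-≤
    (subst ((c · u) ′ ≤_) (sym (≤⇒x′≡[y·x]·y′ u≤c)) (x′≤x·y (c · u) (c ′)))

  ≤𝟘⇒≡𝟘 : ∀ {x} → x ≤ 𝟘 → x ≡ 𝟘
  ≤𝟘⇒≡𝟘 {x} x≤𝟘 = begin
    x                            ≡⟨ sym (x′′≡x x) ⟩
    x ′ · 𝟘                      ≡⟨ cong (_· 𝟘) x≤𝟘 ⟩
    𝟙 · 𝟘                        ≡⟨ 𝟙·𝟘≡𝟘 ⟩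
    𝟘                            ∎

module MonadicQIAProperties {a : Level} (𝔸 : MonadicQIA a) where

  open MonadicQIA 𝔸 hiding (𝟙)
  open BoundedQIA _·_ 𝟘 qi1 qi2 qi3 bounded public

  ◇-mono : ∀ {x y} → x ≤ y → ◇ x ≤ ◇ y
  ◇-mono {x} {y} x≤y = subst (◇ x ≤_) (sym ◇y≡c·◇x) (≤⇒≤·-self ◇x≤c)
    where
    c : Carrier
    c = ◇ x ′ · ◇ y ′

    ◇y≡c·◇x : ◇ y ≡ c · ◇ x
    ◇y≡c·◇x = begin
      ◇ y                        ≡⟨ cong ◇ (sym (≤⇒[y·x]·x≡y x≤y)) ⟩
      ◇ ((y · x) · x)            ≡⟨ cong (λ t → ◇ (t · x)) (sym (≤⇒x′·y′≡y·x x≤y)) ⟩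
      ◇ ((x ′ · y ′) · x)        ≡⟨ m-c x y ⟩
      c · ◇ x                    ∎
      where open ≡-Reasoning

    ◇x≤c : ◇ x ≤ c
    ◇x≤c = subst (_≤ c) (x′′≡x (◇ x)) (x′≤x·y (◇ x ′) (◇ y ′))

  ◇-nonzero : ∀ {x} → ¬ x ≡ 𝟘 → ¬ ◇ x ≡ 𝟘
  ◇-nonzero {x} x≢𝟘 ◇x≡𝟘 = x≢𝟘 (≤𝟘⇒≡𝟘 (subst (x ≤_) ◇x≡𝟘 (m-a2 x)))

  open Induced 𝔸

  ⊥ᴹ-irrefl : ∀ u → ¬ u ⊥ᴹ u
  ⊥ᴹ-irrefl (x , x≢𝟘) x≤x′ = x≢𝟘 (≤𝟘⇒≡𝟘 (trans (sym (x·x′≡x′ x)) x≤x′))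

  ⊥ᴹ-sym : ∀ u v → u ⊥ᴹ v → v ⊥ᴹ u
  ⊥ᴹ-sym (x , _) (y , _) x≤y′ = subst (_≤ x ′) (x′′≡x y) (′-antitone x≤y′)

  Rᴹ-refl : ∀ u → u Rᴹ u
  Rᴹ-refl (x , _) = m-a2 x

  Rᴹ-trans : ∀ u v w → u Rᴹ v → v Rᴹ w → u Rᴹ w
  Rᴹ-trans (x , _) (y , _) (z , _) y≤◇x z≤◇y =
    ≤-trans z≤◇y (≤-trans (◇-mono y≤◇x) (m-a1 x))

  -- ◇ x is itself Rᴹ-related to x, so everything in R[x]^⊥ lies below ◇ x ′,
  -- which is ◇-closed by axiom (b).
  Rᴹ-image-orth-closed : ∀ u w →
    image _Rᴹ_ (orth _⊥ᴹ_ (image _Rᴹ_ (singleton u))) w →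
    orth _⊥ᴹ_ (image _Rᴹ_ (singleton u)) w
  Rᴹ-image-orth-closed (x , x≢𝟘) (z , _) ((y , _) , y⊥Rx , z≤◇y) (v , _) (_ , refl , v≤◇x) =
    ≤-trans z≤◇◇x′ (′-antitone v≤◇x)
    where
    y≤◇x′ : y ≤ ◇ x ′
    y≤◇x′ = y⊥Rx (◇ x , ◇-nonzero x≢𝟘) ((x , x≢𝟘) , refl , ≤-refl (◇ x))

    z≤◇◇x′ : z ≤ ◇ x ′
    z≤◇◇x′ = ≤-trans z≤◇y (subst (◇ y ≤_) (m-b1 x) (◇-mono y≤◇x′))

theorem5p7 : {a : Level} (𝔸 : MonadicQIA a) →
    IsMonadicOrthoframe (Induced.A⁺ 𝔸) (Induced._⊥ᴹ_ 𝔸) (Induced._Rᴹ_ 𝔸)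
theorem5p7 𝔸 = record
  { ⊥-irrefl = ⊥ᴹ-irrefl
  ; ⊥-sym    = ⊥ᴹ-sym
  ; R-refl   = Rᴹ-refl
  ; R-trans  = Rᴹ-trans
  ; cond     = Rᴹ-image-orth-closed
  }
  where open MonadicQIAProperties 𝔸
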